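{- Let $G$ be a connected graph of order $n$ and $x$ a cut-vertex of $G$; let $G_1,\dots,G_M$ be the connected components of $G-x$, with orders $n_1,\dots,n_M$. Suppose either (1) $M\geq 4$, or (2) $M=3$, $\min\{n_1,n_2,n_3\}\geq 2$, and at least two of $n_1,n_2,n_3$ are at least $3$. Then \[(n-1)\prod_{i=1}^M N_i(x) > 2\sum_{i=1}^M (n-n_i)N_i.\]
   Context: A set of vertices is a connected set if it induces a connected subgraph. $G'_i$ is the subgraph of $G$ induced by $V(G_i)\cup\{x\}$; $N_i$ is the number of nonempty connected sets of $G_i$ and $N_i(x)$ is the number of connected sets of $G'_i$ containing $x$. -}

module Defs where

open import Data.Nat using (ℕ; zero; suc; _+_; _*_)
open import Data.Bool using (Bool; true; false; _∧_; _∨_; not; if_then_else_; T)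
open import Data.Fin using (Fin; zero; suc; _≟_)
open import Data.Fin.Subset using (Subset)
open import Data.Vec using (Vec; []; _∷_; lookup)
open import Relation.Nullary.Decidable using (⌊_⌋)
open import Relation.Binary.PropositionalEquality using (_≡_)

record Graph (n : ℕ) : Set where
  field
    adj    : Fin n → Fin n → Bool
    sym    : ∀ u v → adj u v ≡ adj v u
    irrefl : ∀ v → adj v v ≡ false
open Graph public

anyF : ∀ {n} → (Fin n → Bool) → Bool
anyF {zero}  f = false
anyF {suc n} f = f zero ∨ anyF (λ i → f (suc i))

allF : ∀ {n} → (Fin n → Bool) → Bool
allF {zero}  f = true
allF {suc n} f = f zero ∧ allF (λ i → f (suc i))

∑ : ∀ {M} → (Fin M → ℕ) → ℕ
∑ {zero}  f = 0
∑ {suc M} f = f zero + ∑ (λ i → f (suc i))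

∏ : ∀ {M} → (Fin M → ℕ) → ℕ
∏ {zero}  f = 1
∏ {suc M} f = f zero * ∏ (λ i → f (suc i))

mem : ∀ {n} → Fin n → Subset n → Bool
mem v S = lookup S v

nonemptyB : ∀ {n} → Subset n → Bool
nonemptyB S = anyF (λ v → mem v S)

subsetB : ∀ {n} → Subset n → Subset n → Bool
subsetB S T′ = allF (λ v → not (mem v S) ∨ mem v T′)

reach : ∀ {n} → Graph n → Subset n → ℕ → Fin n → Fin n → Bool
reach G S zero    u v = ⌊ u ≟ v ⌋ ∧ mem u S
reach G S (suc k) u v =
  reach G S k u v ∨ anyF (λ w → reach G S k u w ∧ adj G w v ∧ mem v S)

-- S is a connected set: nonempty and the induced subgraph G[S] is connected
-- (any two vertices of S joined by a walk inside S; walks of length ≤ n suffice).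
connectedB : ∀ {n} → Graph n → Subset n → Bool
connectedB {n} G S =
  nonemptyB S ∧ allF (λ u → allF (λ v → not (mem u S ∧ mem v S) ∨ reach G S n u v))

ConnectedSet : ∀ {n} → Graph n → Subset n → Set
ConnectedSet G S = T (connectedB G S)

numSat : ∀ {n} → (Subset n → Bool) → ℕ
numSat {zero}  p = if p [] then 1 else 0
numSat {suc n} p = numSat (λ s → p (true ∷ s)) + numSat (λ s → p (false ∷ s))

-- Number of nonempty connected sets of G contained in the vertex set C
-- (for C = V(G_i), a component of G - x, this is N_i).
numConn : ∀ {n} → Graph n → Subset n → ℕ
numConn G C = numSat (λ S → subsetB S C ∧ connectedB G S)

-- Number of connected sets of G[C ∪ {x}] containing x
-- (for C = V(G_i) this is N_i(x)).
numConnAt : ∀ {n} → Graph n → Subset n → Fin n → ℕ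
numConnAt G C x = numSat (λ S → subsetB S (C Data.Fin.Subset.∪ Data.Fin.Subset.⁅ x ⁆) ∧ mem x S ∧ connectedB G S)

module Submission where

-- Fix a component C of G − x with n_C vertices, N connected subsets, and A connected subsets of
-- C ∪ {x} containing x.  Give each v ∈ C its distance from x inside C ∪ {x} and a shortest walk
-- P(v) from x.  A connected S ⊆ C is determined by its vertex v nearest to x together with
-- S ∪ P(v), a connected set through x other than {x}; hence N ≤ n_C (A − 1).  The sets P(v)
-- together with {x} give A > n_C.
-- Writing Q_i for the product of the A_j with j ≠ i, the size hypotheses give
-- Q_i ≥ 2 (1 + ∑_{j≠i} n_j) = 2 (n − n_i), so 2 (n − n_i) N_i < n_i ∏_j A_j; summing over i and
-- using ∑ n_i = n − 1 gives the inequality.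

open import Defs hiding (sym)
open import Data.Nat using (ℕ; zero; suc; pred; _+_; _*_; _∸_; _≤_; _<_; _≤ᵇ_; z≤n; s≤s; >-nonZero)
open import Data.Nat.Properties hiding (_≟_; suc-injective)
open import Data.Nat.Tactic.RingSolver using (solve-∀)
open import Algebra.Properties.CommutativeSemigroup +-commutativeSemigroup
  using () renaming (x∙yz≈y∙xz to +-left-comm)
open import Algebra.Properties.CommutativeSemigroup *-commutativeSemigroup
  using () renaming (x∙yz≈y∙xz to *-left-comm)
open import Data.Fin using (Fin; zero; suc; _≟_; punchIn; punchOut)
open import Data.Fin.Properties using (all?; any?; ¬∀⟶∃¬; punchIn-punchOut; suc-injective)
open import Data.Fin.Subset using (Subset; _∈_; _∉_; ∣_∣; ⊤; ∁; ⁅_⁆; _∪_; _⊂_)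
open import Data.Fin.Subset.Properties using (∣p∣≤n; p⊂q⇒∣p∣<∣q∣)
open import Data.Bool using (Bool; true; false; _∧_; _∨_; not; T; if_then_else_)
open import Data.Unit using (tt)
open import Data.Empty using (⊥-elim)
open import Data.Product using (Σ; ∃; _×_; _,_; proj₁; proj₂)
open import Data.Sum using (_⊎_; inj₁; inj₂)
open import Data.Vec using ([]; _∷_; tabulate)
open import Data.Vec.Properties
  using ([]=⇒lookup; lookup⇒[]=; lookup-zipWith; lookup-replicate; lookup∘tabulate; ∷-injectiveʳ)
open import Relation.Nullary using (¬_; yes; no)
open import Relation.Nullary.Decidable using (⌊_⌋; toWitness; fromWitness; T?; _→-dec_)
open import Data.List as List using (List; []; _∷_; _++_; length; filter; allFin; cartesianProduct)
open import Data.List.Properties using (length-++; length-map; length-tabulate; map-tabulate)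
open import Data.List.Membership.Propositional using () renaming (_∈_ to _∈ₗ_)
open import Data.List.Membership.Propositional.Properties
  using (∈-∃++; ∈-++⁻; ∈-++⁺ˡ; ∈-++⁺ʳ; ∈-map⁺; ∈-map⁻; ∈-filter⁺; ∈-filter⁻; ∈-allFin; ∈-cartesianProduct⁺)
open import Data.List.Relation.Unary.Any using (here; there)
open import Data.List.Relation.Unary.Any.Properties using (¬Any[])
open import Data.List.Relation.Unary.All as All using (All; []; _∷_)
open import Data.List.Relation.Unary.All.Properties using (All¬⇒¬Any)
open import Data.List.Extrema.Nat using (argmin; argmin-all; f[argmin]≤f[⊤]; f[argmin]≤f[xs])
open import Data.List.Relation.Unary.AllPairs using ([]; _∷_)
open import Data.List.Relation.Unary.Unique.Propositional using (Unique)
import Data.List.Relation.Unary.Unique.Propositional.Properties as Unique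
open import Relation.Binary.PropositionalEquality

T-∧⁺ : ∀ {a b} → T a → T b → T (a ∧ b)
T-∧⁺ {true} _ t = t

T-∧⁻ˡ : ∀ {a b} → T (a ∧ b) → T a
T-∧⁻ˡ {true} _ = tt

T-∧⁻ʳ : ∀ {a b} → T (a ∧ b) → T b
T-∧⁻ʳ {true} t = t

T-∨⁺ˡ : ∀ {a b} → T a → T (a ∨ b)
T-∨⁺ˡ {true} _ = tt

T-∨⁺ʳ : ∀ {a b} → T b → T (a ∨ b)
T-∨⁺ʳ {true} _ = tt
T-∨⁺ʳ {false} t = t

T-∨⁻ : ∀ {a b} → T (a ∨ b) → T a ⊎ T b
T-∨⁻ {true} _ = inj₁ tt
T-∨⁻ {false} t = inj₂ t

T-⇒⁺ : ∀ {a b} → (T a → T b) → T (not a ∨ b)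
T-⇒⁺ {false} _ = tt
T-⇒⁺ {true} f = f tt

T-⇒⁻ : ∀ {a b} → T (not a ∨ b) → T a → T b
T-⇒⁻ {true} t _ = t

T⇒≡true : ∀ {a} → T a → a ≡ true
T⇒≡true {true} _ = refl

¬T⇒≡false : ∀ {a} → ¬ T a → a ≡ false
¬T⇒≡false {false} _ = refl
¬T⇒≡false {true} ¬t = ⊥-elim (¬t tt)

anyF⁺ : ∀ {n} (f : Fin n → Bool) v → T (f v) → T (anyF f)
anyF⁺ f zero t = T-∨⁺ˡ t
anyF⁺ f (suc v) t = T-∨⁺ʳ {f zero} (anyF⁺ (λ i → f (suc i)) v t)

anyF⁻ : ∀ {n} (f : Fin n → Bool) → T (anyF f) → ∃ λ v → T (f v)
anyF⁻ {suc n} f t with T-∨⁻ {f zero} t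
... | inj₁ t₀ = zero , t₀
... | inj₂ t₊ with anyF⁻ (λ i → f (suc i)) t₊
...   | v , tv = suc v , tv

allF⁺ : ∀ {n} (f : Fin n → Bool) → (∀ v → T (f v)) → T (allF f)
allF⁺ {zero} f h = tt
allF⁺ {suc n} f h = T-∧⁺ (h zero) (allF⁺ (λ i → f (suc i)) (λ v → h (suc v)))

allF⁻ : ∀ {n} (f : Fin n → Bool) → T (allF f) → ∀ v → T (f v)
allF⁻ f t zero = T-∧⁻ˡ t
allF⁻ f t (suc v) = allF⁻ (λ i → f (suc i)) (T-∧⁻ʳ {f zero} t) v

∈⇒mem : ∀ {n} {v : Fin n} {S} → v ∈ S → T (mem v S)
∈⇒mem v∈S rewrite []=⇒lookup v∈S = tt

mem⇒∈ : ∀ {n} {v : Fin n} {S} → T (mem v S) → v ∈ S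
mem⇒∈ {v = v} {S} t = lookup⇒[]= v S (T⇒≡true t)

mem-tabulate : ∀ {n} (f : Fin n → Bool) v → mem v (tabulate f) ≡ f v
mem-tabulate f v = lookup∘tabulate f v

mem-⊤ : ∀ {n} (v : Fin n) → T (mem v ⊤)
mem-⊤ v rewrite lookup-replicate v true = tt

mem-⁅⁆ : ∀ {n} (x : Fin n) → T (mem x ⁅ x ⁆)
mem-⁅⁆ zero = tt
mem-⁅⁆ (suc x) = mem-⁅⁆ x

mem-⁅⁆⁻ : ∀ {n} (x v : Fin n) → T (mem v ⁅ x ⁆) → v ≡ x
mem-⁅⁆⁻ zero zero t = refl
mem-⁅⁆⁻ zero (suc v) t rewrite lookup-replicate v false = ⊥-elim t
mem-⁅⁆⁻ (suc x) (suc v) t = cong suc (mem-⁅⁆⁻ x v t)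

mem-∪⁺ˡ : ∀ {n} (p q : Subset n) v → T (mem v p) → T (mem v (p ∪ q))
mem-∪⁺ˡ p q v t rewrite lookup-zipWith _∨_ v p q = T-∨⁺ˡ t

mem-∪⁺ʳ : ∀ {n} (p q : Subset n) v → T (mem v q) → T (mem v (p ∪ q))
mem-∪⁺ʳ p q v t rewrite lookup-zipWith _∨_ v p q = T-∨⁺ʳ {mem v p} t

mem-∪⁻ : ∀ {n} (p q : Subset n) v → T (mem v (p ∪ q)) → T (mem v p) ⊎ T (mem v q)
mem-∪⁻ p q v t rewrite lookup-zipWith _∨_ v p q = T-∨⁻ t

mem-∪⁅⁆⁻ : ∀ {n} (p : Subset n) {v} u → T (mem u (p ∪ ⁅ v ⁆)) → T (mem u p) ⊎ u ≡ v
mem-∪⁅⁆⁻ p {v} u t with mem-∪⁻ p ⁅ v ⁆ u t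
... | inj₁ u∈p = inj₁ u∈p
... | inj₂ u∈⁅v⁆ = inj₂ (mem-⁅⁆⁻ v u u∈⁅v⁆)

subset-ext : ∀ {n} (p q : Subset n) → (∀ v → mem v p ≡ mem v q) → p ≡ q
subset-ext [] [] h = refl
subset-ext (a ∷ p) (b ∷ q) h = cong₂ _∷_ (h zero) (subset-ext p q (λ v → h (suc v)))

subsetB⁺ : ∀ {n} (S C : Subset n) → (∀ u → T (mem u S) → T (mem u C)) → T (subsetB S C)
subsetB⁺ S C h = allF⁺ _ (λ u → T-⇒⁺ (h u))

subsetB⁻ : ∀ {n} (S C : Subset n) → T (subsetB S C) → ∀ u → T (mem u S) → T (mem u C)
subsetB⁻ S C t u = T-⇒⁻ (allF⁻ _ t u)

-- Walks in induced subgraphs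

module Walks {n : ℕ} (G : Graph n) where

  data Walk (S : Subset n) (u : Fin n) : Fin n → Set where
    start  : T (mem u S) → Walk S u u
    extend : ∀ {w v} → Walk S u w → T (adj G w v) → T (mem v S) → Walk S u v

  source∈ : ∀ {S u v} → Walk S u v → T (mem u S)
  source∈ (start t) = t
  source∈ (extend p _ _) = source∈ p

  _++ʷ_ : ∀ {S u v w} → Walk S u v → Walk S v w → Walk S u w
  p ++ʷ start _ = p
  p ++ʷ extend q e t = extend (p ++ʷ q) e t

  prepend : ∀ {S u v w} → T (mem u S) → T (adj G u v) → Walk S v w → Walk S u w
  prepend tu e (start tv) = extend (start tu) e tv
  prepend tu e (extend p e′ t) = extend (prepend tu e p) e′ t

  reverse : ∀ {S u v} → Walk S u v → Walk S v u
  reverse (start t) = start t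
  reverse {v = v} (extend {w} p e t) = prepend t (subst T (Graph.sym G w v) e) (reverse p)

  walk-mono : ∀ {S S′ u v} → (∀ w → T (mem w S) → T (mem w S′)) → Walk S u v → Walk S′ u v
  walk-mono h (start t) = start (h _ t)
  walk-mono h (extend p e t) = extend (walk-mono h p) e (h _ t)

  reach-extend : ∀ {S} k u w v → T (reach G S k u w) → T (adj G w v) → T (mem v S)
               → T (reach G S (suc k) u v)
  reach-extend {S} k u w v r e t =
    T-∨⁺ʳ {reach G S k u v} (anyF⁺ (λ w → reach G S k u w ∧ adj G w v ∧ mem v S) w (T-∧⁺ r (T-∧⁺ e t)))

  reach⇒Walk : ∀ {S} k u v → T (reach G S k u v) → Walk S u v
  reach⇒Walk zero u v r with toWitness {a? = u ≟ v} (T-∧⁻ˡ r)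
  ... | refl = start (T-∧⁻ʳ {⌊ u ≟ u ⌋} r)
  reach⇒Walk {S} (suc k) u v r with T-∨⁻ {reach G S k u v} r
  ... | inj₁ r′ = reach⇒Walk k u v r′
  ... | inj₂ r′ with anyF⁻ _ r′
  ...   | w , t = extend (reach⇒Walk k u w (T-∧⁻ˡ t)) (T-∧⁻ˡ t′) (T-∧⁻ʳ {adj G w v} t′)
    where t′ = T-∧⁻ʳ {reach G S k u w} t

  Walk⇒reach-some : ∀ {S u v} → Walk S u v → ∃ λ k → T (reach G S k u v)
  Walk⇒reach-some {u = u} (start t) = zero , T-∧⁺ (fromWitness {a? = u ≟ u} refl) t
  Walk⇒reach-some {u = u} (extend {w} {v} p e t) with Walk⇒reach-some p
  ... | k , r = suc k , reach-extend k u w v r e t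

  reach-mono : ∀ {S u v} k m → k ≤ m → T (reach G S k u v) → T (reach G S m u v)
  reach-mono {S} {u} {v} k m k≤m r rewrite sym (m∸n+n≡m k≤m) = go (m ∸ k)
    where go : ∀ d → T (reach G S (d + k) u v)
          go zero = r
          go (suc d) = T-∨⁺ˡ (go d)

  -- The sets reachable within k steps grow with k; once they stop growing they are stable
  -- for ever, and since they live in Fin n they cannot grow more than n times.
  module _ (S : Subset n) (u : Fin n) where
    private
      R : ℕ → Fin n → Bool
      R k = reach G S k u

      Stable : ℕ → Set
      Stable j = ∀ v → T (R (suc j) v) → T (R j v)

      stable-forever : ∀ {j} → Stable j → ∀ m v → T (R (m + j) v) → T (R j v)
      stable-forever st zero v r = r
      stable-forever {j} st (suc m) v r with T-∨⁻ {R (m + j) v} r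
      ... | inj₁ r′ = stable-forever st m v r′
      ... | inj₂ r′ with anyF⁻ _ r′
      ...   | w , t = st v (reach-extend j u w v (stable-forever st m w (T-∧⁻ˡ t))
                                        (T-∧⁻ˡ t′) (T-∧⁻ʳ {adj G w v} t′))
        where t′ = T-∧⁻ʳ {R (m + j) w} t

      reachable : ℕ → Subset n
      reachable k = tabulate (R k)

      ∈-reachable⁺ : ∀ k {v} → T (R k v) → v ∈ reachable k
      ∈-reachable⁺ k {v} r = mem⇒∈ (subst T (sym (mem-tabulate (R k) v)) r)

      ∈-reachable⁻ : ∀ k {v} → v ∈ reachable k → T (R k v)
      ∈-reachable⁻ k {v} v∈ = subst T (mem-tabulate (R k) v) (∈⇒mem v∈)

      stable-or-grows : ∀ k → (∃ λ j → j < k × Stable j) ⊎ k ≤ ∣ reachable k ∣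
      stable-or-grows zero = inj₂ z≤n
      stable-or-grows (suc k) with stable-or-grows k
      ... | inj₁ (j , j<k , st) = inj₁ (j , m≤n⇒m≤1+n j<k , st)
      ... | inj₂ k≤∣R∣ with all? (λ v → T? (R (suc k) v) →-dec T? (R k v))
      ...   | yes st = inj₁ (k , ≤-refl , st)
      ...   | no ¬st = inj₂ (≤-trans (s≤s k≤∣R∣) (p⊂q⇒∣p∣<∣q∣ R[k]⊂R[1+k]))
        where
          R[k]⊂R[1+k] : reachable k ⊂ reachable (suc k)
          R[k]⊂R[1+k] with ¬∀⟶∃¬ n _ (λ v → T? (R (suc k) v) →-dec T? (R k v)) ¬st
          ... | v , ¬imp with T? (R (suc k) v) | T? (R k v)
          ...   | yes r₁ | yes r₀ = ⊥-elim (¬imp (λ _ → r₀))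
          ...   | yes r₁ | no ¬r₀ = (λ v∈ → ∈-reachable⁺ (suc k) (T-∨⁺ˡ (∈-reachable⁻ k v∈)))
                                  , v , ∈-reachable⁺ (suc k) r₁ , (λ v∈ → ¬r₀ (∈-reachable⁻ k v∈))
          ...   | no ¬r₁ | _ = ⊥-elim (¬imp (λ r₁ → ⊥-elim (¬r₁ r₁)))

      stable-within-n : ∃ λ j → j ≤ n × Stable j
      stable-within-n with stable-or-grows (suc n)
      ... | inj₁ (j , s≤s j≤n , st) = j , j≤n , st
      ... | inj₂ 1+n≤∣R∣ = ⊥-elim (<-irrefl refl (≤-trans 1+n≤∣R∣ (∣p∣≤n (reachable (suc n)))))

    reach⇒reach-n : ∀ k v → T (R k v) → T (R n v)
    reach⇒reach-n k v r with stable-within-n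
    ... | j , j≤n , st with ≤-total k j
    ...   | inj₁ k≤j = reach-mono j n j≤n (reach-mono k j k≤j r)
    ...   | inj₂ j≤k =
      reach-mono j n j≤n (stable-forever st (k ∸ j) v (subst (λ i → T (R i v)) (sym (m∸n+n≡m j≤k)) r))

  Walk⇒reach : ∀ {S u v} → Walk S u v → T (reach G S n u v)
  Walk⇒reach {S} {u} {v} p = let k , r = Walk⇒reach-some p in reach⇒reach-n S u k v r

  connected⇒Walk : ∀ {S} → T (connectedB G S) → ∀ u v → T (mem u S) → T (mem v S) → Walk S u v
  connected⇒Walk {S} c u v tu tv =
    reach⇒Walk n u v (T-⇒⁻ (allF⁻ _ (allF⁻ _ (T-∧⁻ʳ {nonemptyB S} c) u) v) (T-∧⁺ tu tv))

  rooted⇒connected : ∀ {S} r → T (mem r S) → (∀ v → T (mem v S) → Walk S r v) → T (connectedB G S)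
  rooted⇒connected {S} r tr walk =
    T-∧⁺ (anyF⁺ _ r tr)
         (allF⁺ _ λ u → allF⁺ _ λ v → T-⇒⁺ {mem u S ∧ mem v S} λ t →
           Walk⇒reach (reverse (walk u (T-∧⁻ˡ t)) ++ʷ walk v (T-∧⁻ʳ {mem u S} t)))

-- Distances from x and shortest walks

module Geodesics {n : ℕ} (G : Graph n) (S : Subset n) (x : Fin n) where
  open Walks G

  private
    R : ℕ → Fin n → Bool
    R k = reach G S k x

  levelFrom : ℕ → ℕ → Fin n → ℕ
  levelFrom j zero v = j
  levelFrom j (suc f) v = if R j v then j else levelFrom (suc j) f v

  levelFrom-least : ∀ f j k v → j ≤ k → k ≤ f + j → T (R k v)
                  → levelFrom j f v ≤ k × T (R (levelFrom j f v) v)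
  levelFrom-least zero j k v j≤k k≤j r rewrite ≤-antisym j≤k k≤j = ≤-refl , r
  levelFrom-least (suc f) j k v j≤k k≤f+j r with R j v in eq
  ... | true = j≤k , subst T (sym eq) tt
  ... | false with m≤n⇒m<n∨m≡n j≤k
  ...   | inj₂ refl = ⊥-elim (subst T eq r)
  ...   | inj₁ j<k = levelFrom-least f (suc j) k v j<k (subst (k ≤_) (sym (+-suc f j)) k≤f+j) r

  -- The distance from x to v inside S (junk value n if v is unreachable).
  level : Fin n → ℕ
  level v = levelFrom 0 n v

  level-least : ∀ k v → T (R k v) → level v ≤ k × T (R (level v) v)
  level-least k v r with ≤-total k n
  ... | inj₁ k≤n = levelFrom-least n 0 k v z≤n (subst (k ≤_) (sym (+-identityʳ n)) k≤n) r
  ... | inj₂ n≤k =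
    let L≤n , rL = levelFrom-least n 0 n v z≤n (≤-reflexive (sym (+-identityʳ n))) (reach⇒reach-n S x k v r)
    in ≤-trans L≤n n≤k , rL

  <-level : ∀ k k′ v → ¬ T (R k v) → T (R k′ v) → k < level v
  <-level k k′ v ¬r r = ≰⇒> λ L≤k → ¬r (reach-mono (level v) k L≤k (proj₂ (level-least k′ v r)))

  record IsGeodesic (Q : Subset n) (v : Fin n) : Set where
    field
      end∈   : T (mem v Q)
      ⊆S     : ∀ u → T (mem u Q) → T (mem u S)
      rooted : ∀ u → T (mem u Q) → Walk Q x u
      below  : ∀ u → T (mem u Q) → u ≢ v → level u < level v

    level≤ : ∀ u → T (mem u Q) → level u ≤ level v
    level≤ u u∈Q with u ≟ v
    ... | yes refl = ≤-refl
    ... | no u≢v = <⇒≤ (below u u∈Q u≢v)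

  geodesic-end-unique : ∀ {Q a b} → IsGeodesic Q a → IsGeodesic Q b → a ≡ b
  geodesic-end-unique {a = a} {b} geo-a geo-b with a ≟ b
  ... | yes a≡b = a≡b
  ... | no a≢b = ⊥-elim (<-asym (below geo-b a (end∈ geo-a) a≢b) (below geo-a b (end∈ geo-b) (≢-sym a≢b)))
    where open IsGeodesic

  geodesic-root : T (mem x S) → IsGeodesic ⁅ x ⁆ x
  geodesic-root x∈S = record
    { end∈   = mem-⁅⁆ x
    ; ⊆S     = λ u u∈ → subst (λ z → T (mem z S)) (sym (mem-⁅⁆⁻ x u u∈)) x∈S
    ; rooted = λ u u∈ → subst (Walk ⁅ x ⁆ x) (sym (mem-⁅⁆⁻ x u u∈)) (start (mem-⁅⁆ x))
    ; below  = λ u u∈ u≢x → ⊥-elim (u≢x (mem-⁅⁆⁻ x u u∈))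
    }

  geodesic-snoc : ∀ {Q w v} → IsGeodesic Q w → T (adj G w v) → T (mem v S) → level w < level v
                → IsGeodesic (Q ∪ ⁅ v ⁆) v
  geodesic-snoc {Q} {w} {v} geo e v∈S w<v =
    record { end∈ = v∈ ; ⊆S = ⊆S′ ; rooted = rooted′ ; below = below′ }
    where
      open IsGeodesic geo
      incl : ∀ u → T (mem u Q) → T (mem u (Q ∪ ⁅ v ⁆))
      incl = mem-∪⁺ˡ Q ⁅ v ⁆
      v∈ : T (mem v (Q ∪ ⁅ v ⁆))
      v∈ = mem-∪⁺ʳ Q ⁅ v ⁆ v (mem-⁅⁆ v)

      ⊆S′ : ∀ u → T (mem u (Q ∪ ⁅ v ⁆)) → T (mem u S)
      ⊆S′ u u∈ with mem-∪⁅⁆⁻ Q u u∈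
      ... | inj₁ u∈Q = ⊆S u u∈Q
      ... | inj₂ refl = v∈S

      rooted′ : ∀ u → T (mem u (Q ∪ ⁅ v ⁆)) → Walk (Q ∪ ⁅ v ⁆) x u
      rooted′ u u∈ with mem-∪⁅⁆⁻ Q u u∈
      ... | inj₁ u∈Q = walk-mono incl (rooted u u∈Q)
      ... | inj₂ refl = extend (walk-mono incl (rooted w end∈)) e v∈

      below′ : ∀ u → T (mem u (Q ∪ ⁅ v ⁆)) → u ≢ v → level u < level v
      below′ u u∈ u≢v with mem-∪⁅⁆⁻ Q u u∈
      ... | inj₁ u∈Q = ≤-<-trans (level≤ u u∈Q) w<v
      ... | inj₂ u≡v = ⊥-elim (u≢v u≡v)

  predecessor : ℕ → Fin n → Fin n
  predecessor k v with any? (λ w → T? (R k w ∧ adj G w v ∧ mem v S))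
  ... | yes (w , _) = w
  ... | no _ = v

  predecessor-correct : ∀ k v → T (anyF (λ w → R k w ∧ adj G w v ∧ mem v S))
                      → T (R k (predecessor k v) ∧ adj G (predecessor k v) v ∧ mem v S)
  predecessor-correct k v t with any? (λ w → T? (R k w ∧ adj G w v ∧ mem v S))
  ... | yes (w , tw) = tw
  ... | no ¬∃ = ⊥-elim (¬∃ (anyF⁻ _ t))

  geodesic : ℕ → Fin n → Subset n
  geodesic zero v = ⁅ v ⁆
  geodesic (suc k) v = if R k v then geodesic k v else geodesic k (predecessor k v) ∪ ⁅ v ⁆

  geodesic-correct : ∀ k v → T (R k v) → IsGeodesic (geodesic k v) v
  geodesic-correct zero v r with toWitness {a? = x ≟ v} (T-∧⁻ˡ r)
  ... | refl = geodesic-root (T-∧⁻ʳ {⌊ x ≟ x ⌋} r)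
  geodesic-correct (suc k) v r with R k v in eq
  ... | true = geodesic-correct k v (subst T (sym eq) tt)
  ... | false = geodesic-snoc (geodesic-correct k w Rw) (T-∧⁻ˡ t) (T-∧⁻ʳ {adj G w v} t) w<v
    where
      w = predecessor k v
      pw = predecessor-correct k v r
      Rw = T-∧⁻ˡ pw
      t = T-∧⁻ʳ {R k w} pw
      w<v : level w < level v
      w<v = ≤-<-trans (proj₁ (level-least k w Rw))
                      (<-level k (suc k) v (subst T eq) (T-∨⁺ʳ {R k v} r))

  shortest : Fin n → Subset n
  shortest = geodesic n

  shortest-correct : ∀ {v} → Walk S x v → IsGeodesic (shortest v) v
  shortest-correct {v} p = geodesic-correct n v (Walk⇒reach p)

-- Counting subsets through lists

filterᵇ : ∀ {A : Set} → (A → Bool) → List A → List A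
filterᵇ p = filter (λ a → T? (p a))

filterᵇ-++ : ∀ {A : Set} (p : A → Bool) xs ys → filterᵇ p (xs ++ ys) ≡ filterᵇ p xs ++ filterᵇ p ys
filterᵇ-++ p [] ys = refl
filterᵇ-++ p (a ∷ xs) ys with p a
... | true = cong (a ∷_) (filterᵇ-++ p xs ys)
... | false = filterᵇ-++ p xs ys

filterᵇ-map : ∀ {A B : Set} (p : B → Bool) (f : A → B) xs
            → filterᵇ p (List.map f xs) ≡ List.map f (filterᵇ (λ a → p (f a)) xs)
filterᵇ-map p f [] = refl
filterᵇ-map p f (a ∷ xs) with p (f a)
... | true = cong (f a ∷_) (filterᵇ-map p f xs)
... | false = filterᵇ-map p f xs

length-filterᵇ-map : ∀ {A B : Set} (p : B → Bool) (f : A → B) xs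
                   → length (filterᵇ p (List.map f xs)) ≡ length (filterᵇ (λ a → p (f a)) xs)
length-filterᵇ-map p f xs = trans (cong length (filterᵇ-map p f xs)) (length-map f (filterᵇ (λ a → p (f a)) xs))

length-cartesianProduct : ∀ {A B : Set} (xs : List A) (ys : List B)
                        → length (cartesianProduct xs ys) ≡ length xs * length ys
length-cartesianProduct [] ys = refl
length-cartesianProduct (a ∷ xs) ys = begin
  length (List.map (a ,_) ys ++ cartesianProduct xs ys)  ≡⟨ length-++ (List.map (a ,_) ys) ⟩
  length (List.map (a ,_) ys) + length (cartesianProduct xs ys)
    ≡⟨ cong₂ _+_ (length-map (a ,_) ys) (length-cartesianProduct xs ys) ⟩
  length ys + length xs * length ys  ∎
  where open ≡-Reasoning

unique-length-≤ : ∀ {A : Set} {xs ys : List A} → Unique xs → (∀ {a} → a ∈ₗ xs → a ∈ₗ ys)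
                → length xs ≤ length ys
unique-length-≤ [] _ = z≤n
unique-length-≤ {xs = a ∷ xs} {ys} (a∉xs ∷ xs!) xs⊆ys with ∈-∃++ (xs⊆ys (here refl))
... | ys₁ , ys₂ , refl = begin
  suc (length xs)              ≤⟨ s≤s (unique-length-≤ xs! xs⊆ys₁ys₂) ⟩
  suc (length (ys₁ ++ ys₂))    ≡⟨ cong suc (length-++ ys₁) ⟩
  suc (length ys₁ + length ys₂) ≡⟨ sym (+-suc (length ys₁) (length ys₂)) ⟩
  length ys₁ + length (a ∷ ys₂) ≡⟨ sym (length-++ ys₁) ⟩
  length (ys₁ ++ a ∷ ys₂)       ∎
  where
    open ≤-Reasoning
    xs⊆ys₁ys₂ : ∀ {b} → b ∈ₗ xs → b ∈ₗ ys₁ ++ ys₂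
    xs⊆ys₁ys₂ b∈xs with ∈-++⁻ ys₁ (xs⊆ys (there b∈xs))
    ... | inj₁ b∈ys₁ = ∈-++⁺ˡ b∈ys₁
    ... | inj₂ (here refl) = ⊥-elim (All¬⇒¬Any a∉xs b∈xs)
    ... | inj₂ (there b∈ys₂) = ∈-++⁺ʳ ys₁ b∈ys₂

map-unique : ∀ {A B : Set} (f : A → B) {xs} → Unique xs
           → (∀ {a b} → a ∈ₗ xs → b ∈ₗ xs → f a ≡ f b → a ≡ b) → Unique (List.map f xs)
map-unique f [] inj = []
map-unique f {a ∷ xs} (a∉xs ∷ xs!) inj =
  fresh xs (λ b∈ → b∈) ∷ map-unique f xs! (λ p q → inj (there p) (there q))
  where
    fresh : ∀ zs → (∀ {b} → b ∈ₗ zs → b ∈ₗ xs) → All (f a ≢_) (List.map f zs)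
    fresh [] _ = []
    fresh (z ∷ zs) zs⊆xs = fa≢fz ∷ fresh zs (λ b∈ → zs⊆xs (there b∈))
      where
        z∈xs = zs⊆xs (here refl)
        fa≢fz : f a ≢ f z
        fa≢fz fa≡fz = All¬⇒¬Any a∉xs (subst (_∈ₗ xs) (sym (inj (here refl) (there z∈xs) fa≡fz)) z∈xs)

length-≤-injection : ∀ {A B : Set} {xs : List A} {ys : List B} (f : A → B) → Unique xs
                   → (∀ {a b} → a ∈ₗ xs → b ∈ₗ xs → f a ≡ f b → a ≡ b)
                   → (∀ {a} → a ∈ₗ xs → f a ∈ₗ ys) → length xs ≤ length ys
length-≤-injection {xs = xs} f xs! inj maps =
  subst (_≤ _) (length-map f xs) (unique-length-≤ (map-unique f xs! inj) image⊆)
  where image⊆ : ∀ {b} → b ∈ₗ List.map f xs → b ∈ₗ _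
        image⊆ b∈ with ∈-map⁻ f b∈
        ... | a , a∈ , refl = maps a∈

subsets : ∀ n → List (Subset n)
subsets zero = [] ∷ []
subsets (suc n) = List.map (true ∷_) (subsets n) ++ List.map (false ∷_) (subsets n)

∈-subsets : ∀ {n} (S : Subset n) → S ∈ₗ subsets n
∈-subsets [] = here refl
∈-subsets {suc n} (true ∷ S) = ∈-++⁺ˡ (∈-map⁺ (true ∷_) (∈-subsets S))
∈-subsets {suc n} (false ∷ S) =
  ∈-++⁺ʳ (List.map (true ∷_) (subsets n)) (∈-map⁺ (false ∷_) (∈-subsets S))

subsets-unique : ∀ n → Unique (subsets n)
subsets-unique zero = [] ∷ []
subsets-unique (suc n) =
  Unique.++⁺ (Unique.map⁺ ∷-injectiveʳ (subsets-unique n))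
             (Unique.map⁺ ∷-injectiveʳ (subsets-unique n)) disjoint
  where disjoint : ∀ {S} → ¬ (S ∈ₗ List.map (true ∷_) (subsets n)
                            × S ∈ₗ List.map (false ∷_) (subsets n))
        disjoint (S∈₁ , S∈₂) with ∈-map⁻ _ S∈₁ | ∈-map⁻ _ S∈₂
        ... | _ , _ , refl | _ , _ , ()

satisfying : ∀ {n} → (Subset n → Bool) → List (Subset n)
satisfying p = filterᵇ p (subsets _)

numSat≡length : ∀ {n} (p : Subset n → Bool) → numSat p ≡ length (satisfying p)
numSat≡length {zero} p with p []
... | true = refl
... | false = refl
numSat≡length {suc n} p = begin
  numSat (λ S → p (true ∷ S)) + numSat (λ S → p (false ∷ S))
    ≡⟨ cong₂ _+_ (numSat≡length (λ S → p (true ∷ S))) (numSat≡length (λ S → p (false ∷ S))) ⟩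
  length (filterᵇ (λ S → p (true ∷ S)) (subsets n)) + length (filterᵇ (λ S → p (false ∷ S)) (subsets n))
    ≡⟨ sym (cong₂ _+_ (length-filterᵇ-map p (true ∷_) (subsets n))
                      (length-filterᵇ-map p (false ∷_) (subsets n))) ⟩
  length (filterᵇ p (List.map (true ∷_) (subsets n))) + length (filterᵇ p (List.map (false ∷_) (subsets n)))
    ≡⟨ sym (length-++ (filterᵇ p (List.map (true ∷_) (subsets n)))) ⟩
  length (filterᵇ p (List.map (true ∷_) (subsets n)) ++ filterᵇ p (List.map (false ∷_) (subsets n)))
    ≡⟨ cong length (sym (filterᵇ-++ p (List.map (true ∷_) (subsets n)) _)) ⟩
  length (satisfying p)  ∎
  where open ≡-Reasoning

∈-satisfying⁺ : ∀ {n} (p : Subset n → Bool) {S} → T (p S) → S ∈ₗ satisfying p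
∈-satisfying⁺ p {S} t = ∈-filter⁺ (λ S → T? (p S)) (∈-subsets S) t

∈-satisfying⁻ : ∀ {n} (p : Subset n → Bool) {S} → S ∈ₗ satisfying p → T (p S)
∈-satisfying⁻ p S∈ = proj₂ (∈-filter⁻ (λ S → T? (p S)) {xs = subsets _} S∈)

satisfying-unique : ∀ {n} (p : Subset n → Bool) → Unique (satisfying p)
satisfying-unique p = Unique.filter⁺ (λ S → T? (p S)) (subsets-unique _)

members : ∀ {n} → Subset n → List (Fin n)
members S = filterᵇ (λ v → mem v S) (allFin _)

∈-members⁺ : ∀ {n} (S : Subset n) {v} → T (mem v S) → v ∈ₗ members S
∈-members⁺ S {v} t = ∈-filter⁺ (λ v → T? (mem v S)) (∈-allFin v) t

∈-members⁻ : ∀ {n} (S : Subset n) {v} → v ∈ₗ members S → T (mem v S)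
∈-members⁻ S v∈ = proj₂ (∈-filter⁻ (λ v → T? (mem v S)) {xs = allFin _} v∈)

members-unique : ∀ {n} (S : Subset n) → Unique (members S)
members-unique S = Unique.filter⁺ (λ v → T? (mem v S)) (Unique.allFin⁺ _)

length-members : ∀ {n} (S : Subset n) → length (members S) ≡ ∣ S ∣
length-members-tail : ∀ {n} {b} (S : Subset n)
                    → length (filterᵇ (λ v → mem v (b ∷ S)) (List.tabulate suc)) ≡ ∣ S ∣

length-members [] = refl
length-members (true ∷ S) = cong suc (length-members-tail S)
length-members (false ∷ S) = length-members-tail S

length-members-tail {n} {b} S = begin
  length (filterᵇ (λ v → mem v (b ∷ S)) (List.tabulate suc))
    ≡⟨ cong (λ vs → length (filterᵇ (λ v → mem v (b ∷ S)) vs)) (sym (map-tabulate (λ v → v) suc)) ⟩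
  length (filterᵇ (λ v → mem v (b ∷ S)) (List.map suc (allFin n)))  ≡⟨ length-filterᵇ-map _ suc (allFin n) ⟩
  length (members S)                                                ≡⟨ length-members S ⟩
  ∣ S ∣  ∎
  where open ≡-Reasoning

nonempty⇒size≥1 : ∀ {n} (S : Subset n) → T (nonemptyB S) → 1 ≤ ∣ S ∣
nonempty⇒size≥1 S ne =
  let v , v∈S = anyF⁻ (λ v → mem v S) ne in subst (1 ≤_) (length-members S) (∈⇒length≥1 (∈-members⁺ S v∈S))
  where ∈⇒length≥1 : ∀ {vs} {v : Fin _} → v ∈ₗ vs → 1 ≤ length vs
        ∈⇒length≥1 {_ ∷ _} _ = s≤s z≤n

concatFin : ∀ {A : Set} {M} → (Fin M → List A) → List A
concatFin {M = zero} f = []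
concatFin {M = suc M} f = f zero ++ concatFin (λ i → f (suc i))

length-concatFin : ∀ {A : Set} {M} (f : Fin M → List A) → length (concatFin f) ≡ ∑ (λ i → length (f i))
length-concatFin {M = zero} f = refl
length-concatFin {M = suc M} f =
  trans (length-++ (f zero)) (cong (length (f zero) +_) (length-concatFin (λ i → f (suc i))))

∈-concatFin⁺ : ∀ {A : Set} {M} (f : Fin M → List A) i {a} → a ∈ₗ f i → a ∈ₗ concatFin f
∈-concatFin⁺ f zero a∈ = ∈-++⁺ˡ a∈
∈-concatFin⁺ f (suc i) a∈ = ∈-++⁺ʳ (f zero) (∈-concatFin⁺ (λ i → f (suc i)) i a∈)

∈-concatFin⁻ : ∀ {A : Set} {M} (f : Fin M → List A) {a} → a ∈ₗ concatFin f → ∃ λ i → a ∈ₗ f i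
∈-concatFin⁻ {M = suc M} f a∈ with ∈-++⁻ (f zero) a∈
... | inj₁ a∈₀ = zero , a∈₀
... | inj₂ a∈₊ = let i , a∈ᵢ = ∈-concatFin⁻ (λ i → f (suc i)) a∈₊ in suc i , a∈ᵢ

concatFin-unique : ∀ {A : Set} {M} (f : Fin M → List A) → (∀ i → Unique (f i))
                 → (∀ i j {a} → i ≢ j → a ∈ₗ f i → ¬ a ∈ₗ f j) → Unique (concatFin f)
concatFin-unique {M = zero} f f! disjoint = []
concatFin-unique {M = suc M} f f! disjoint =
  Unique.++⁺ (f! zero)
             (concatFin-unique (λ i → f (suc i)) (λ i → f! (suc i))
                               (λ i j i≢j → disjoint (suc i) (suc j) (λ eq → i≢j (suc-injective eq))))
             (λ (a∈₀ , a∈₊) → let i , a∈ᵢ = ∈-concatFin⁻ (λ i → f (suc i)) a∈₊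
                             in disjoint zero (suc i) (λ ()) a∈₀ a∈ᵢ)

-- Connected sets in one component of G − x

module Component {n : ℕ} (G : Graph n) (C : Subset n) (x : Fin n) (x∉C : ¬ T (mem x C))
                 (x-reaches : ∀ v → T (mem v C) → Walks.Walk G (C ∪ ⁅ x ⁆) x v) where
  open Walks G
  open Geodesics G (C ∪ ⁅ x ⁆) x
  open IsGeodesic

  connectedIn : Subset n → Bool
  connectedIn S = subsetB S C ∧ connectedB G S

  connectedAt : Subset n → Bool
  connectedAt S = subsetB S (C ∪ ⁅ x ⁆) ∧ mem x S ∧ connectedB G S

  connectedAt⁺ : Subset n → Bool
  connectedAt⁺ S = connectedAt S ∧ anyF (λ u → mem u S ∧ not ⌊ u ≟ x ⌋)

  ≢x : ∀ {v} → T (mem v C) → v ≢ x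
  ≢x v∈C refl = x∉C v∈C

  ≢x⇒T : ∀ {v} → v ≢ x → T (not ⌊ v ≟ x ⌋)
  ≢x⇒T {v} v≢x with v ≟ x
  ... | yes v≡x = v≢x v≡x
  ... | no _ = tt

  geodesic-connectedAt : ∀ {Q v} → IsGeodesic Q v → T (connectedAt Q)
  geodesic-connectedAt {Q} {v} geo =
    T-∧⁺ (subsetB⁺ Q (C ∪ ⁅ x ⁆) (⊆S geo)) (T-∧⁺ x∈Q (rooted⇒connected x x∈Q (rooted geo)))
    where x∈Q = source∈ (rooted geo v (end∈ geo))

  shortest-in : ∀ {v} → T (mem v C) → IsGeodesic (shortest v) v
  shortest-in v∈C = shortest-correct (x-reaches _ v∈C)

  ⁅x⁆-geodesic : IsGeodesic ⁅ x ⁆ x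
  ⁅x⁆-geodesic = geodesic-root (mem-∪⁺ʳ C ⁅ x ⁆ x (mem-⁅⁆ x))

  ⁅x⁆-connectedAt : T (connectedAt ⁅ x ⁆)
  ⁅x⁆-connectedAt = geodesic-connectedAt ⁅x⁆-geodesic

  ⁅x⁆-not-connectedAt⁺ : ¬ T (connectedAt⁺ ⁅ x ⁆)
  ⁅x⁆-not-connectedAt⁺ t with anyF⁻ _ (T-∧⁻ʳ {connectedAt ⁅ x ⁆} t)
  ... | u , u∈ with mem-⁅⁆⁻ x u (T-∧⁻ˡ u∈) | T-∧⁻ʳ {mem u ⁅ x ⁆} u∈
  ...   | refl | u≢x with x ≟ x
  ...     | yes _ = u≢x
  ...     | no x≢x = x≢x refl

  lowest : Subset n → Fin n
  lowest S with members S
  ... | [] = x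
  ... | v ∷ vs = argmin level v vs

  lowest-correct : ∀ S → T (nonemptyB S)
                 → T (mem (lowest S) S) × (∀ u → T (mem u S) → level (lowest S) ≤ level u)
  lowest-correct S ne with members S in eq
  ... | [] = let u , u∈S = anyF⁻ _ ne in ⊥-elim (¬Any[] (subst (u ∈ₗ_) eq (∈-members⁺ S u∈S)))
  ... | v ∷ vs = ∈-members⁻ S (subst (_ ∈ₗ_) (sym eq) lowest∈)
               , λ u u∈S → minimal (subst (u ∈ₗ_) eq (∈-members⁺ S u∈S))
    where lowest∈ : argmin level v vs ∈ₗ v ∷ vs
          lowest∈ = argmin-all level {P = _∈ₗ v ∷ vs} (here refl) (All.tabulate there)
          minimal : ∀ {u} → u ∈ₗ v ∷ vs → level (argmin level v vs) ≤ level u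
          minimal (here refl) = f[argmin]≤f[⊤] {f = level} v vs
          minimal (there u∈vs) = All.lookup (f[argmin]≤f[xs] {f = level} v vs) u∈vs

  -- restrictAbove inverts extendToRoot on connected S ⊆ C: S lies at or above the level of its
  -- lowest vertex v, while every vertex of shortest v other than v lies strictly below it.
  extendToRoot : Subset n → Fin n × Subset n
  extendToRoot S = lowest S , S ∪ shortest (lowest S)

  restrictAbove : Fin n × Subset n → Subset n
  restrictAbove (v , Q) = tabulate (λ u → mem u Q ∧ (level v ≤ᵇ level u))

  module _ {S : Subset n} (S∈ : T (connectedIn S)) where
    private
      S⊆C : ∀ u → T (mem u S) → T (mem u C)
      S⊆C = subsetB⁻ S C (T-∧⁻ˡ S∈)
      S-connected : T (connectedB G S)
      S-connected = T-∧⁻ʳ {subsetB S C} S∈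
      v = lowest S
      v∈S = proj₁ (lowest-correct S (T-∧⁻ˡ S-connected))
      v-lowest = proj₂ (lowest-correct S (T-∧⁻ˡ S-connected))
      v∈C = S⊆C v v∈S
      geo = shortest-in v∈C
      U = S ∪ shortest v
      S⊆U = mem-∪⁺ˡ S (shortest v)
      P⊆U = mem-∪⁺ʳ S (shortest v)

    lowest-in-C : T (mem (lowest S) C)
    lowest-in-C = v∈C

    extendToRoot-connectedAt⁺ : T (connectedAt⁺ (S ∪ shortest (lowest S)))
    extendToRoot-connectedAt⁺ =
      T-∧⁺ (T-∧⁺ (subsetB⁺ U (C ∪ ⁅ x ⁆) U⊆C∪x)
                 (T-∧⁺ (source∈ x⇝v) (rooted⇒connected x (source∈ x⇝v) x⇝)))
           (anyF⁺ _ v (T-∧⁺ (S⊆U v v∈S) (≢x⇒T (≢x v∈C))))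
      where
        x⇝v : Walk U x v
        x⇝v = walk-mono P⊆U (rooted geo v (end∈ geo))
        x⇝ : ∀ u → T (mem u U) → Walk U x u
        x⇝ u u∈U with mem-∪⁻ S (shortest v) u u∈U
        ... | inj₁ u∈S = x⇝v ++ʷ walk-mono S⊆U (connected⇒Walk S-connected v u v∈S u∈S)
        ... | inj₂ u∈P = walk-mono P⊆U (rooted geo u u∈P)
        U⊆C∪x : ∀ u → T (mem u U) → T (mem u (C ∪ ⁅ x ⁆))
        U⊆C∪x u u∈U with mem-∪⁻ S (shortest v) u u∈U
        ... | inj₁ u∈S = mem-∪⁺ˡ C ⁅ x ⁆ u (S⊆C u u∈S)
        ... | inj₂ u∈P = ⊆S geo u u∈P

    restrict∘extend : restrictAbove (extendToRoot S) ≡ S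
    restrict∘extend = subset-ext _ S λ u → trans (mem-tabulate _ u) (agrees u)
      where
        agrees : ∀ u → (mem u U ∧ (level v ≤ᵇ level u)) ≡ mem u S
        agrees u with T? (mem u S)
        ... | yes u∈S = trans (T⇒≡true (T-∧⁺ (S⊆U u u∈S) (≤⇒≤ᵇ (v-lowest u u∈S)))) (sym (T⇒≡true u∈S))
        ... | no u∉S = trans (¬T⇒≡false below-v) (sym (¬T⇒≡false u∉S))
          where
            below-v : ¬ T (mem u U ∧ (level v ≤ᵇ level u))
            below-v t with mem-∪⁻ S (shortest v) u (T-∧⁻ˡ t)
            ... | inj₁ u∈S = u∉S u∈S
            ... | inj₂ u∈P = <⇒≱ (below geo u u∈P (λ { refl → u∉S v∈S }))
                                 (≤ᵇ⇒≤ (level v) (level u) (T-∧⁻ʳ {mem u U} t))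

  numConn≤size*numConnAt⁺ : numConn G C ≤ ∣ C ∣ * numSat connectedAt⁺
  numConn≤size*numConnAt⁺ = begin
    numConn G C                      ≡⟨ numSat≡length connectedIn ⟩
    length (satisfying connectedIn)
      ≤⟨ length-≤-injection extendToRoot (satisfying-unique connectedIn) injective maps ⟩
    length (cartesianProduct (members C) (satisfying connectedAt⁺))
      ≡⟨ length-cartesianProduct (members C) (satisfying connectedAt⁺) ⟩
    length (members C) * length (satisfying connectedAt⁺)
      ≡⟨ cong₂ _*_ (length-members C) (sym (numSat≡length connectedAt⁺)) ⟩
    ∣ C ∣ * numSat connectedAt⁺  ∎
    where
      open ≤-Reasoning
      injective : ∀ {S S′} → S ∈ₗ satisfying connectedIn → S′ ∈ₗ satisfying connectedIn
                → extendToRoot S ≡ extendToRoot S′ → S ≡ S′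
      injective {S} {S′} S∈ S′∈ eq =
        trans (sym (restrict∘extend (∈-satisfying⁻ connectedIn S∈)))
              (trans (cong restrictAbove eq) (restrict∘extend (∈-satisfying⁻ connectedIn S′∈)))
      maps : ∀ {S} → S ∈ₗ satisfying connectedIn
           → extendToRoot S ∈ₗ cartesianProduct (members C) (satisfying connectedAt⁺)
      maps S∈ = ∈-cartesianProduct⁺ (∈-members⁺ C (lowest-in-C S∈′))
                                    (∈-satisfying⁺ connectedAt⁺ (extendToRoot-connectedAt⁺ S∈′))
        where S∈′ = ∈-satisfying⁻ connectedIn S∈

  numConnAt⁺<numConnAt : numSat connectedAt⁺ < numConnAt G C x
  numConnAt⁺<numConnAt = begin-strict
    numSat connectedAt⁺                  ≡⟨ numSat≡length connectedAt⁺ ⟩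
    length (satisfying connectedAt⁺)     <⟨ n<1+n _ ⟩
    length (⁅ x ⁆ ∷ satisfying connectedAt⁺)
      ≤⟨ unique-length-≤ (≢⁅x⁆ ∷ satisfying-unique connectedAt⁺) ⊆connectedAt ⟩
    length (satisfying connectedAt)      ≡⟨ sym (numSat≡length connectedAt) ⟩
    numConnAt G C x  ∎
    where
      open ≤-Reasoning
      ≢⁅x⁆ : All (⁅ x ⁆ ≢_) (satisfying connectedAt⁺)
      ≢⁅x⁆ = All.tabulate λ S∈ → λ { refl → ⁅x⁆-not-connectedAt⁺ (∈-satisfying⁻ connectedAt⁺ S∈) }
      ⊆connectedAt : ∀ {S} → S ∈ₗ ⁅ x ⁆ ∷ satisfying connectedAt⁺
                   → S ∈ₗ satisfying connectedAt
      ⊆connectedAt (here refl) = ∈-satisfying⁺ connectedAt ⁅x⁆-connectedAt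
      ⊆connectedAt (there S∈) = ∈-satisfying⁺ connectedAt (T-∧⁻ˡ (∈-satisfying⁻ connectedAt⁺ S∈))

  size<numConnAt : ∣ C ∣ < numConnAt G C x
  size<numConnAt = begin-strict
    ∣ C ∣                                     ≡⟨ sym (trans (length-map shortest (members C)) (length-members C)) ⟩
    length (List.map shortest (members C))    <⟨ n<1+n _ ⟩
    length (⁅ x ⁆ ∷ List.map shortest (members C))
      ≤⟨ unique-length-≤ (All.tabulate {xs = List.map shortest (members C)} ≢⁅x⁆
                            ∷ map-unique shortest (members-unique C) injective) ⊆connectedAt ⟩
    length (satisfying connectedAt)           ≡⟨ sym (numSat≡length connectedAt) ⟩
    numConnAt G C x  ∎
    where
      open ≤-Reasoning
      shortest-of : ∀ {v} → v ∈ₗ members C → IsGeodesic (shortest v) v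
      shortest-of v∈ = shortest-in (∈-members⁻ C v∈)
      injective : ∀ {a b} → a ∈ₗ members C → b ∈ₗ members C → shortest a ≡ shortest b → a ≡ b
      injective {a} a∈ b∈ eq = geodesic-end-unique (subst (λ Q → IsGeodesic Q a) eq (shortest-of a∈)) (shortest-of b∈)
      ≢⁅x⁆ : ∀ {Q} → Q ∈ₗ List.map shortest (members C) → ⁅ x ⁆ ≢ Q
      ≢⁅x⁆ Q∈ ⁅x⁆≡Q with ∈-map⁻ shortest Q∈
      ... | v , v∈ , refl =
        ≢x (∈-members⁻ C v∈) (geodesic-end-unique (subst (λ Q → IsGeodesic Q v) (sym ⁅x⁆≡Q) (shortest-of v∈)) ⁅x⁆-geodesic)
      ⊆connectedAt : ∀ {Q} → Q ∈ₗ ⁅ x ⁆ ∷ List.map shortest (members C) → Q ∈ₗ satisfying connectedAt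
      ⊆connectedAt (here refl) = ∈-satisfying⁺ connectedAt ⁅x⁆-connectedAt
      ⊆connectedAt (there Q∈) with ∈-map⁻ shortest Q∈
      ... | v , v∈ , refl = ∈-satisfying⁺ connectedAt (geodesic-connectedAt (shortest-of v∈))

  numConn≤size*pred-numConnAt : numConn G C ≤ ∣ C ∣ * pred (numConnAt G C x)
  numConn≤size*pred-numConnAt =
    ≤-trans numConn≤size*numConnAt⁺ (*-monoʳ-≤ ∣ C ∣ (<⇒≤pred numConnAt⁺<numConnAt))

∑-cong : ∀ {M} {f g : Fin M → ℕ} → (∀ i → f i ≡ g i) → ∑ f ≡ ∑ g
∑-cong {zero} h = refl
∑-cong {suc M} h = cong₂ _+_ (h zero) (∑-cong (λ i → h (suc i)))

∑-punchIn : ∀ {M} (f : Fin (suc M) → ℕ) i → ∑ f ≡ f i + ∑ (λ j → f (punchIn i j))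
∑-punchIn f zero = refl
∑-punchIn {suc M} f (suc i) =
  trans (cong (f zero +_) (∑-punchIn (λ j → f (suc j)) i)) (+-left-comm (f zero) (f (suc i)) _)

∏-punchIn : ∀ {M} (f : Fin (suc M) → ℕ) i → ∏ f ≡ f i * ∏ (λ j → f (punchIn i j))
∏-punchIn f zero = refl
∏-punchIn {suc M} f (suc i) =
  trans (cong (f zero *_) (∏-punchIn (λ j → f (suc j)) i)) (*-left-comm (f zero) (f (suc i)) _)

∑-mono-< : ∀ {M} {f g : Fin (suc M) → ℕ} → (∀ i → f i < g i) → ∑ f < ∑ g
∑-mono-< {zero} h = +-mono-<-≤ (h zero) ≤-refl
∑-mono-< {suc M} h = +-mono-<-≤ (h zero) (<⇒≤ (∑-mono-< (λ i → h (suc i))))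

∑-distribˡ : ∀ {M} c (f : Fin M → ℕ) → ∑ (λ i → c * f i) ≡ c * ∑ f
∑-distribˡ {zero} c f = sym (*-zeroʳ c)
∑-distribˡ {suc M} c f =
  trans (cong (c * f zero +_) (∑-distribˡ c (λ i → f (suc i)))) (sym (*-distribˡ-+ c (f zero) _))

∑-distribʳ : ∀ {M} c (f : Fin M → ℕ) → ∑ (λ i → f i * c) ≡ ∑ f * c
∑-distribʳ {zero} c f = refl
∑-distribʳ {suc M} c f =
  trans (cong (f zero * c +_) (∑-distribʳ c (λ i → f (suc i)))) (sym (*-distribʳ-+ c (f zero) _))

∏-mono-≤ : ∀ {M} {f g : Fin M → ℕ} → (∀ i → f i ≤ g i) → ∏ f ≤ ∏ g
∏-mono-≤ {zero} h = ≤-refl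
∏-mono-≤ {suc M} h = *-mono-≤ (h zero) (∏-mono-≤ (λ i → h (suc i)))

2*[1+∑]≤∏[1+]-≥3 : ∀ K (h : Fin (3 + K) → ℕ) → (∀ j → 1 ≤ h j) → 2 * suc (∑ h) ≤ ∏ (λ j → suc (h j))
2*[1+∑]≤∏[1+]-≥3 zero h h≥1 = triple (h≥1 zero) (h≥1 (suc zero)) (h≥1 (suc (suc zero)))
  where
    triple : ∀ {a b c} → 1 ≤ a → 1 ≤ b → 1 ≤ c
           → 2 * suc (a + (b + (c + 0))) ≤ suc a * (suc b * (suc c * 1))
    triple (s≤s (z≤n {p})) (s≤s (z≤n {q})) (s≤s (z≤n {r})) =
      ≤-trans (m≤m+n _ _) (≤-reflexive (sym (expand p q r)))
      where
        expand : ∀ p q r → (2 + p) * ((2 + q) * ((2 + r) * 1))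
               ≡ 2 * suc (suc p + (suc q + (suc r + 0)))
                 + (2 * (p + q + r) + 2 * (p * q + q * r + p * r) + p * q * r)
        expand = solve-∀
2*[1+∑]≤∏[1+]-≥3 (suc K) h h≥1 = begin
  2 * suc (h₀ + s)                   ≤⟨ m≤m+n _ _ ⟩
  2 * suc (h₀ + s) + 2 * h₀ * s      ≡⟨ sym (expand h₀ s) ⟩
  suc h₀ * (2 * suc s)
    ≤⟨ *-monoʳ-≤ (suc h₀) (2*[1+∑]≤∏[1+]-≥3 K (λ j → h (suc j)) (λ j → h≥1 (suc j))) ⟩
  suc h₀ * ∏ (λ j → suc (h (suc j)))  ∎
  where
    open ≤-Reasoning
    h₀ = h zero
    s = ∑ (λ j → h (suc j))
    expand : ∀ h s → suc h * (2 * suc s) ≡ 2 * suc (h + s) + 2 * h * s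
    expand = solve-∀

2*[1+∑]≤∏[1+]-pair : (h : Fin 2 → ℕ) → (∀ j → 2 ≤ h j) → 3 ≤ h zero ⊎ 3 ≤ h (suc zero)
                    → 2 * suc (∑ h) ≤ ∏ (λ j → suc (h j))
2*[1+∑]≤∏[1+]-pair h h≥2 h≥3 = pair (h≥2 zero) (h≥2 (suc zero)) h≥3
  where
    pair : ∀ {a b} → 2 ≤ a → 2 ≤ b → 3 ≤ a ⊎ 3 ≤ b → 2 * suc (a + (b + 0)) ≤ suc a * (suc b * 1)
    pair (s≤s (s≤s z≤n)) (s≤s (s≤s (z≤n {q}))) (inj₁ (s≤s (s≤s (s≤s (z≤n {p}))))) =
      ≤-trans (m≤m+n _ _) (≤-reflexive (sym (expand p q)))
      where
        expand : ∀ p q → (4 + p) * ((3 + q) * 1) ≡ 2 * suc (3 + p + (2 + q + 0)) + (p + 2 * q + p * q)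
        expand = solve-∀
    pair (s≤s (s≤s (z≤n {p}))) (s≤s (s≤s z≤n)) (inj₂ (s≤s (s≤s (s≤s (z≤n {q}))))) =
      ≤-trans (m≤m+n _ _) (≤-reflexive (sym (expand p q)))
      where
        expand : ∀ p q → (3 + p) * ((4 + q) * 1) ≡ 2 * suc (2 + p + (3 + q + 0)) + (2 * p + q + p * q)
        expand = solve-∀

≢⇒punchIn₀⊎punchIn₁ : ∀ {P : Fin 3 → Set} i k → i ≢ k → P k
                     → P (punchIn i zero) ⊎ P (punchIn i (suc zero))
≢⇒punchIn₀⊎punchIn₁ {P} i k i≢k Pk with punchOut i≢k | punchIn-punchOut i≢k
... | zero | eq = inj₁ (subst P (sym eq) Pk)
... | suc zero | eq = inj₂ (subst P (sym eq) Pk)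

2*[1+∑others]≤∏others : ∀ M (m a : Fin (suc M) → ℕ) → (∀ i → m i < a i) → (∀ i → 1 ≤ m i)
  → (4 ≤ suc M)
    ⊎ (suc M ≡ 3 × (∀ i → 2 ≤ m i)
       × (Σ (Fin (suc M)) λ i → Σ (Fin (suc M)) λ j → i ≢ j × 3 ≤ m i × 3 ≤ m j))
  → ∀ i → 2 * suc (∑ (λ j → m (punchIn i j))) ≤ ∏ (λ j → a (punchIn i j))
2*[1+∑others]≤∏others M m a m<a m≥1 (inj₁ (s≤s (s≤s (s≤s (s≤s {n = K} _))))) i =
  ≤-trans (2*[1+∑]≤∏[1+]-≥3 K (λ j → m (punchIn i j)) (λ j → m≥1 (punchIn i j)))
          (∏-mono-≤ (λ j → m<a (punchIn i j)))
2*[1+∑others]≤∏others M m a m<a m≥1 (inj₂ (refl , m≥2 , k , l , k≢l , m≥3ₖ , m≥3ₗ)) i =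
  ≤-trans (2*[1+∑]≤∏[1+]-pair (λ j → m (punchIn i j)) (λ j → m≥2 (punchIn i j)) one-≥3)
          (∏-mono-≤ (λ j → m<a (punchIn i j)))
  where
    one-≥3 : 3 ≤ m (punchIn i zero) ⊎ 3 ≤ m (punchIn i (suc zero))
    one-≥3 with k ≟ i
    ... | yes refl = ≢⇒punchIn₀⊎punchIn₁ {λ j → 3 ≤ m j} k l k≢l m≥3ₗ
    ... | no k≢i = ≢⇒punchIn₀⊎punchIn₁ {λ j → 3 ≤ m j} i k (λ i≡k → k≢i (sym i≡k)) m≥3ₖ

weighted-sum< : ∀ M N (m a b : Fin (suc M) → ℕ) → N ≡ suc (∑ m)
  → (∀ i → 1 ≤ m i) → (∀ i → m i < a i) → (∀ i → b i ≤ m i * pred (a i))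
  → (∀ i → 2 * suc (∑ (λ j → m (punchIn i j))) ≤ ∏ (λ j → a (punchIn i j)))
  → 2 * ∑ (λ i → (N ∸ m i) * b i) < (N ∸ 1) * ∏ a
weighted-sum< M N m a b N≡ m≥1 m<a b≤ others = begin-strict
  2 * ∑ (λ i → (N ∸ m i) * b i)    ≡⟨ sym (∑-distribˡ 2 (λ i → (N ∸ m i) * b i)) ⟩
  ∑ (λ i → 2 * ((N ∸ m i) * b i))  <⟨ ∑-mono-< summand< ⟩
  ∑ (λ i → m i * ∏ a)              ≡⟨ ∑-distribʳ (∏ a) m ⟩
  ∑ m * ∏ a                        ≡⟨ cong (λ k → pred k * ∏ a) (sym N≡) ⟩
  (N ∸ 1) * ∏ a                    ∎
  where
    open ≤-Reasoning
    summand< : ∀ i → 2 * ((N ∸ m i) * b i) < m i * ∏ a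
    summand< i = begin-strict
      2 * ((N ∸ m i) * b i)      ≡⟨ sym (*-assoc 2 (N ∸ m i) (b i)) ⟩
      2 * (N ∸ m i) * b i        ≡⟨ cong (λ k → 2 * k * b i) N∸mᵢ ⟩
      2 * suc s * b i            ≤⟨ *-monoˡ-≤ (b i) (others i) ⟩
      Q * b i                    ≤⟨ *-monoʳ-≤ Q (b≤ i) ⟩
      Q * (m i * pred (a i))
        <⟨ *-monoʳ-< Q {{>-nonZero Q>0}} (*-monoʳ-< (m i) {{>-nonZero (m≥1 i)}} pred-aᵢ<aᵢ) ⟩
      Q * (m i * a i)            ≡⟨ *-left-comm Q (m i) (a i) ⟩
      m i * (Q * a i)            ≡⟨ cong (m i *_) (trans (*-comm Q (a i)) (sym (∏-punchIn a i))) ⟩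
      m i * ∏ a                  ∎
      where
        s = ∑ (λ j → m (punchIn i j))
        Q = ∏ (λ j → a (punchIn i j))
        Q>0 : 0 < Q
        Q>0 = ≤-trans (s≤s z≤n) (others i)
        pred-aᵢ<aᵢ : pred (a i) < a i
        pred-aᵢ<aᵢ = ≤-reflexive (suc-pred (a i) {{>-nonZero (<-≤-trans (m≥1 i) (<⇒≤ (m<a i)))}})
        N∸mᵢ : N ∸ m i ≡ suc s
        N∸mᵢ = begin-equality
          N ∸ m i              ≡⟨ cong (_∸ m i) (trans N≡ (cong suc (∑-punchIn m i))) ⟩
          suc (m i + s) ∸ m i  ≡⟨ cong (_∸ m i) (sym (+-suc (m i) s)) ⟩
          m i + suc s ∸ m i    ≡⟨ m+n∸m≡n (m i) (suc s) ⟩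
          suc s                ∎

-- The components of G − x

vertex-count : ∀ {n} (x : Fin n) {M} (comp : Fin M → Subset n)
  → (∀ i → x ∉ comp i)
  → (∀ v → v ≢ x → ∃ λ i → v ∈ comp i)
  → (∀ i j v → i ≢ j → v ∈ comp i → v ∉ comp j)
  → n ≡ suc (∑ (λ i → ∣ comp i ∣))
vertex-count {n} x comp x∉ cover disjoint = ≤-antisym
  (subst₂ _≤_ (length-tabulate (λ v → v)) length-vertices
            (unique-length-≤ (Unique.allFin⁺ n) all∈))
  (subst₂ _≤_ length-vertices (length-tabulate (λ v → v))
            (unique-length-≤ vertices-unique (λ {v} _ → ∈-allFin v)))
  where
    vertices : List (Fin n)
    vertices = x ∷ concatFin (λ i → members (comp i))
    length-vertices : length vertices ≡ suc (∑ (λ i → ∣ comp i ∣))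
    length-vertices =
      cong suc (trans (length-concatFin (λ i → members (comp i))) (∑-cong (λ i → length-members (comp i))))
    all∈ : ∀ {v} → v ∈ₗ allFin n → v ∈ₗ vertices
    all∈ {v} _ with v ≟ x
    ... | yes refl = here refl
    ... | no v≢x = let i , v∈ = cover v v≢x in there (∈-concatFin⁺ _ i (∈-members⁺ (comp i) (∈⇒mem v∈)))
    vertices-unique : Unique vertices
    vertices-unique =
      All.tabulate (λ v∈ x≡v → let i , x∈ = ∈-concatFin⁻ _ v∈ in x∉ i (∈comp i (subst (_∈ₗ _) (sym x≡v) x∈)))
      ∷ concatFin-unique _ (λ i → members-unique (comp i))
          (λ i j i≢j v∈ᵢ v∈ⱼ → disjoint i j _ i≢j (∈comp i v∈ᵢ) (∈comp j v∈ⱼ))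
      where ∈comp : ∀ i {v} → v ∈ₗ members (comp i) → v ∈ comp i
            ∈comp i v∈ = mem⇒∈ (∈-members⁻ (comp i) v∈)

module _ {n : ℕ} (G : Graph n) (x : Fin n) {M : ℕ} (comp : Fin M → Subset n)
         (x∉ : ∀ i → x ∉ comp i)
         (cover : ∀ v → v ≢ x → ∃ λ i → v ∈ comp i)
         (no-edges : ∀ i j u v → i ≢ j → u ∈ comp i → v ∈ comp j → adj G u v ≡ false) where
  open Walks G

  -- Since no edge leaves a component, the part of a walk from x after its last visit to x
  -- stays inside the component of its end point.
  walk-into-component : ∀ i {v} → Walk ⊤ x v → T (mem v (comp i)) → Walk (comp i ∪ ⁅ x ⁆) x v
  walk-into-component i (start _) x∈ = ⊥-elim (x∉ i (mem⇒∈ x∈))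
  walk-into-component i {v} (extend {w} p e _) v∈ with w ≟ x
  ... | yes refl =
    extend (start (mem-∪⁺ʳ (comp i) ⁅ x ⁆ x (mem-⁅⁆ x))) e (mem-∪⁺ˡ (comp i) ⁅ x ⁆ v v∈)
  ... | no w≢x with cover w w≢x
  ...   | j , w∈ with j ≟ i
  ...     | yes refl = extend (walk-into-component j p (∈⇒mem w∈)) e (mem-∪⁺ˡ (comp j) ⁅ x ⁆ v v∈)
  ...     | no j≢i = ⊥-elim (subst T (no-edges j i w v j≢i w∈ (mem⇒∈ v∈)) e)

lemma6p5 : (n : ℕ) (G : Graph n) (x : Fin n)
    → ConnectedSet G ⊤
    → ¬ ConnectedSet G (∁ ⁅ x ⁆)
    → (M : ℕ) (comp : Fin M → Subset n)
    → (∀ i → ConnectedSet G (comp i))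
    → (∀ i → x ∉ comp i)
    → (∀ v → v ≢ x → ∃ λ i → v ∈ comp i)
    → (∀ i j v → i ≢ j → v ∈ comp i → v ∉ comp j)
    → (∀ i j u v → i ≢ j → u ∈ comp i → v ∈ comp j → adj G u v ≡ false)
    → (4 ≤ M)
      ⊎ (M ≡ 3 × (∀ i → 2 ≤ ∣ comp i ∣)
           × (Σ (Fin M) λ i → Σ (Fin M) λ j → i ≢ j × 3 ≤ ∣ comp i ∣ × 3 ≤ ∣ comp j ∣))
    → 2 * ∑ (λ i → (n ∸ ∣ comp i ∣) * numConn G (comp i))
      < (n ∸ 1) * ∏ (λ i → numConnAt G (comp i) x)
lemma6p5 n G x _ _ zero comp _ _ _ _ _ (inj₁ ())
lemma6p5 n G x _ _ zero comp _ _ _ _ _ (inj₂ (() , _))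
lemma6p5 n G x G-connected _ (suc M) comp comp-connected x∉ cover disjoint no-edges sizes =
  weighted-sum< M n size numConnAt-x numConn-G
    (vertex-count x comp x∉ cover disjoint) size≥1 size<numConnAt numConn≤
    (2*[1+∑others]≤∏others M size numConnAt-x size<numConnAt size≥1 sizes)
  where
    size numConnAt-x numConn-G : Fin (suc M) → ℕ
    size i = ∣ comp i ∣
    numConnAt-x i = numConnAt G (comp i) x
    numConn-G i = numConn G (comp i)

    x-reaches : ∀ i v → T (mem v (comp i)) → Walks.Walk G (comp i ∪ ⁅ x ⁆) x v
    x-reaches i v v∈ = walk-into-component G x comp x∉ cover no-edges i
                         (Walks.connected⇒Walk G G-connected x v (mem-⊤ x) (mem-⊤ v)) v∈

    module Cᵢ i = Component G (comp i) x (λ x∈ → x∉ i (mem⇒∈ x∈)) (x-reaches i)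

    size≥1 : ∀ i → 1 ≤ size i
    size≥1 i = nonempty⇒size≥1 (comp i) (T-∧⁻ˡ (comp-connected i))

    size<numConnAt : ∀ i → size i < numConnAt-x i
    size<numConnAt i = Cᵢ.size<numConnAt i

    numConn≤ : ∀ i → numConn-G i ≤ size i * pred (numConnAt-x i)
    numConn≤ i = Cᵢ.numConn≤size*pred-numConnAt i
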